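{- Let $H$ be a digraph, $s\in V(H)$ a vertex from which every vertex of $H$ is reachable, and let $(\hat T,\{B_x\}_{x\in\hat T})$ be the $s$-rooted cut decomposition of $H$. Let $y$ be a node of $\hat T$ such that the path $\hat P_{sy}$ from $s$ to $y$ in $\hat T$ contains at least $\ell$ nodes whose diblocks are non-degenerate. Then $H$ contains an out-tree rooted at $s$ with at least $\ell$ leaves.
   Context: An out-tree is an oriented tree with exactly one vertex of in-degree zero (its root); its leaves are its vertices of out-degree zero. A vertex $v$ is bi-reachable from $r$ if there exist two internally vertex-disjoint directed paths from $r$ to $v$. For a digraph $H$ with at least two vertices and $r\in V(H)$ from which every vertex is reachable, the diblock $B_r$ of $r$ in $H$ is the set of vertices bi-reachable from $r$ together with $r$ and all out-neighbours of $r$. For $x\in B_r\setminus\{r\}$ let $X_x$ be the set of vertices $v\in V(H)\setminus B_r$ such that every directed path from $r$ to $v$ intersects $B_r$ for the last time in $x$; $x$ is a bottleneck of $B_r$ if $X_x\neq\emptyset$, and $L$ denotes the set of bottlenecks. The $r$-rooted cut decomposition of $H$ is the pair $(\hat T,\{B_x\}_{x\in\hat T})$ defined recursively: $B_r$ is the diblock of $r$ in $H$; for each $x\in L$ let $(\hat T_x,\mathcal B_x)$ be the $x$-rooted cut decomposition of $H[X_x\cup\{x\}]$; $\hat T$ is the rooted tree (whose nodes are vertices of $H$) with root $r$, set of children of $r$ equal to $L$, and subtree rooted at each $x\in L$ equal to $\hat T_x$; and the collection of diblocks is $\{B_r\}\cup\bigcup_{x\in L}\mathcal B_x$. A diblock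 $B_x$ is degenerate if $x$ is an internal (non-leaf) node of $\hat T$ and $|B_x|=2$; otherwise it is non-degenerate. -}

module Defs where

open import Level using (0ℓ)
open import Data.Nat using (ℕ; zero; suc; _≤_)
open import Data.Fin using (Fin)
open import Data.Bool using (Bool; true)
open import Data.List using (List; []; _∷_; _++_)
open import Data.List.Membership.Propositional using (_∈_; _∉_)
open import Data.List.Relation.Unary.All using (All)
open import Data.Product using (Σ; ∃; ∃-syntax; _×_; _,_)
open import Data.Sum using (_⊎_)
open import Data.Unit using (⊤)
open import Relation.Nullary using (¬_)
open import Relation.Unary using (Pred)
open import Relation.Binary.PropositionalEquality using (_≡_; _≢_)
open import Relation.Binary.Construct.Closure.ReflexiveTransitive using (Star)
open import Function.Definitions using (Injective)

module _ {n : ℕ} (E : Fin n → Fin n → Bool) where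

  Arc : Fin n → Fin n → Set
  Arc a b = E a b ≡ true

  All-V : Pred (Fin n) 0ℓ
  All-V _ = ⊤

  -- DPath U a b vs : vs is the vertex sequence of a directed path (no repeated
  -- vertices) from a to b in the induced subdigraph H[U].
  data DPath (U : Pred (Fin n) 0ℓ) : Fin n → Fin n → List (Fin n) → Set where
    single : ∀ {a} → U a → DPath U a a (a ∷ [])
    cons   : ∀ {a b c vs} → U a → Arc a b → DPath U b c vs → a ∉ vs →
             DPath U a c (a ∷ vs)

  Reachable : Pred (Fin n) 0ℓ → Fin n → Fin n → Set
  Reachable U a b = ∃[ vs ] DPath U a b vs

  BiReachable : Pred (Fin n) 0ℓ → Fin n → Fin n → Set
  BiReachable U r v =
    ∃[ ps ] ∃[ qs ] (DPath U r v ps × DPath U r v qs ×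
      (∀ w → w ∈ ps → w ∈ qs → w ≡ r ⊎ w ≡ v))

  Diblock : Pred (Fin n) 0ℓ → Fin n → Pred (Fin n) 0ℓ
  Diblock U r v = U v × (v ≡ r ⊎ Arc r v ⊎ BiReachable U r v)

  LastIn : Pred (Fin n) 0ℓ → List (Fin n) → Fin n → Set
  LastIn B vs x = B x × ∃[ pre ] ∃[ post ]
    (vs ≡ pre ++ (x ∷ post) × All (λ w → ¬ B w) post)

  Xset : Pred (Fin n) 0ℓ → Fin n → Fin n → Pred (Fin n) 0ℓ
  Xset U r x v = U v × ¬ Diblock U r v ×
    (∀ vs → DPath U r v vs → LastIn (Diblock U r) vs x)

  Bottleneck : Pred (Fin n) 0ℓ → Fin n → Fin n → Set
  Bottleneck U r x = Diblock U r x × x ≢ r × ∃ (Xset U r x)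

  SubSet : Pred (Fin n) 0ℓ → Fin n → Fin n → Pred (Fin n) 0ℓ
  SubSet U r x v = Xset U r x v ⊎ v ≡ x

  -- r is an internal node of the (r-rooted) cut decomposition tree of H[U],
  -- i.e. B_r has a bottleneck (its children in the tree are the bottlenecks).
  Internal : Pred (Fin n) 0ℓ → Fin n → Set
  Internal U r = ∃ (Bottleneck U r)

  HasExactlyTwo : Pred (Fin n) 0ℓ → Set
  HasExactlyTwo B = ∃[ a ] ∃[ b ] (a ≢ b × B a × B b × (∀ w → B w → w ≡ a ⊎ w ≡ b))

  Degenerate : Pred (Fin n) 0ℓ → Fin n → Set
  Degenerate U r = Internal U r × HasExactlyTwo (Diblock U r)

  -- TreePath U r y k : y is a node of the r-rooted cut decomposition of H[U],
  -- and the tree path from r to y contains exactly k nodes whose diblocks are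
  -- non-degenerate.  (The subtree of a child x of r is the x-rooted cut
  -- decomposition of H[X_x ∪ {x}], so degeneracy of x is computed there.)
  data TreePath : Pred (Fin n) 0ℓ → Fin n → Fin n → ℕ → Set₁ where
    stop-nd : ∀ {U r} → ¬ Degenerate U r → TreePath U r r 1
    stop-d  : ∀ {U r} → Degenerate U r → TreePath U r r 0
    step-nd : ∀ {U r x y k} → ¬ Degenerate U r → Bottleneck U r x →
              TreePath (SubSet U r x) x y k → TreePath U r y (suc k)
    step-d  : ∀ {U r x y k} → Degenerate U r → Bottleneck U r x →
              TreePath (SubSet U r x) x y k → TreePath U r y k

  record OutTree (s : Fin n) : Set₁ where
    field
      V      : Pred (Fin n) 0ℓ
      A      : Fin n → Fin n → Set
      A⊆Arc  : ∀ {a b} → A a b → Arc a b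
      A-ends : ∀ {a b} → A a b → V a × V b
      root∈  : V s
      root-in0 : ∀ a → ¬ A a s
      in1    : ∀ v → V v → v ≢ s → ∃[ a ] (A a v × (∀ a' → A a' v → a' ≡ a))
      reach  : ∀ v → V v → Star A s v

    Leaf : Fin n → Set
    Leaf v = V v × (∀ w → ¬ A v w)

  AtLeastLeaves : ∀ {s} → OutTree s → ℕ → Set
  AtLeastLeaves T ℓ = ∃[ f ] (Injective _≡_ _≡_ f × (∀ (i : Fin ℓ) → OutTree.Leaf T (f i)))

module Submission where

-- Walking down the tree path from s, a node r with a non-degenerate diblock
-- and next node x (a bottleneck of B_r) has a third diblock vertex w ∉ {r, x};
-- w is reached from r avoiding x, and x from r avoiding w.  Gluing these paths
-- produces ℓ distinct "leaf candidates", each reached from s by a walk whose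
-- earlier vertices avoid all candidates.  A breadth-first search from s that
-- never expands a candidate then builds an out-tree in which every candidate
-- is a leaf.
--
-- Non-degeneracy only says that B_r is not {r, x}, so the third vertex, and
-- hence the candidate list, exists only up to double negation.  This is
-- removed at the end: the BFS layers are decidable subsets of Fin n that
-- saturate after n rounds, so "some list of ℓ distinct vertices is reached by
-- its own blocked search" is decidable.

open import Defs
open import Data.Nat using (ℕ; _≤_)
open import Data.Fin using (Fin)
open import Data.Bool using (Bool)
open import Data.Product using (∃-syntax)

open import Level using (0ℓ)
import Data.Fin as Fin
open import Function using (_∘_; id)
open import Function.Definitions using (Injective)
open import Data.Nat using (zero; suc; _+_; _∸_; z≤n; s≤s; _≤′_; ≤′-reflexive; ≤′-step)
import Data.Nat.Properties as ℕ
open import Data.Bool using (true)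
open import Data.Bool.Properties using () renaming (_≟_ to _≟ᵇ_)
open import Data.Fin.Properties using (_≟_; any?)
open import Data.Fin.Subset using (Subset; ⁅_⁆; _∪_; _⊆_; _⊂_; ∣_∣)
  renaming (_∈_ to _∈ₛ_; _∉_ to _∉ₛ_)
open import Data.Fin.Subset.Properties
  using (x∈⁅x⁆; x∈⁅y⁆⇒x≡y; ∣⁅x⁆∣≡1; p⊆p∪q; x∈p∪q⁺; x∈p∪q⁻; _⊂?_; p⊂q⇒∣p∣<∣q∣; ∣p∣≤n)
  renaming (_∈?_ to _∈ₛ?_)
open import Data.Vec using (tabulate)
open import Data.Vec.Properties using (lookup∘tabulate; []=⇒lookup; lookup⇒[]=)
open import Data.Maybe using (Maybe; just)
import Data.Maybe as Maybe
open import Data.Maybe.Properties using (just-injective)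
open import Data.List using (List; []; _∷_; length; lookup)
open import Data.List.Membership.Propositional using (_∈_; _∉_)
open import Data.List.Membership.Propositional.Properties using (∈-lookup; ∈-++⁺ʳ)
open import Data.List.Relation.Unary.Any using (here; there)
open import Data.List.Relation.Unary.All as All using (All; []; _∷_)
open import Data.List.Relation.Unary.AllPairs as AllPairs using (AllPairs; []; _∷_)
open import Data.Product using (∃; _×_; _,_; proj₁; proj₂)
open import Data.Sum using (_⊎_; inj₁; inj₂)
import Data.Sum as Sum
open import Data.Unit using (tt)
open import Relation.Nullary using (¬_; Dec; yes; no)
open import Relation.Nullary.Decidable using (_×-dec_; ¬?; decidable-stable)
import Relation.Nullary.Decidable as Dec
open import Relation.Nullary.Negation using (contradiction; contradiction₂; ¬¬-map; ¬¬-Monad)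
open import Relation.Unary using (Pred; Decidable)
open import Relation.Binary using (tri<; tri≈; tri>)
open import Relation.Binary.PropositionalEquality using (_≡_; _≢_; refl; sym; trans; subst; cong)
open import Relation.Binary.Construct.Closure.ReflexiveTransitive using (Star; ε; _◅_; _◅◅_)
import Relation.Binary.Construct.Closure.ReflexiveTransitive as Star
open import Effect.Monad using (RawMonad)

fromDec : ∀ {n} {P : Pred (Fin n) 0ℓ} → Decidable P → Subset n
fromDec P? = tabulate (Dec.does ∘ P?)

∈-fromDec⁺ : ∀ {n} {P : Pred (Fin n) 0ℓ} (P? : Decidable P) {v} → P v → v ∈ₛ fromDec P?
∈-fromDec⁺ P? {v} pv =
  lookup⇒[]= v _ (trans (lookup∘tabulate (Dec.does ∘ P?) v) (Dec.dec-true (P? v) pv))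

∈-fromDec⁻ : ∀ {n} {P : Pred (Fin n) 0ℓ} (P? : Decidable P) {v} → v ∈ₛ fromDec P? → P v
∈-fromDec⁻ P? {v} v∈ = from-does (P? v) (trans (sym (lookup∘tabulate (Dec.does ∘ P?) v)) ([]=⇒lookup v∈))
  where
    from-does : ∀ {A : Set} (a? : Dec A) → Dec.does a? ≡ true → A
    from-does (yes a) _ = a
    from-does (no _) ()

-- A deterministic choice of witness from a decision of an existential; used
-- to give every BFS vertex a unique parent.
choice : ∀ {n} {P : Pred (Fin n) 0ℓ} → Dec (∃ P) → Maybe (Fin n)
choice = Maybe.map proj₁ ∘ Dec.dec⇒maybe

choice-sound : ∀ {n} {P : Pred (Fin n) 0ℓ} (p? : Dec (∃ P)) {a} → choice p? ≡ just a → P a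
choice-sound (yes (_ , pa)) refl = pa
choice-sound (no _) ()

choice-complete : ∀ {n} {P : Pred (Fin n) 0ℓ} (p? : Dec (∃ P)) → ∃ P → ∃[ a ] (choice p? ≡ just a)
choice-complete (yes (a , _)) _ = a , refl
choice-complete (no ¬p) p = contradiction p ¬p

any-list? : ∀ {n} {P : Pred (List (Fin n)) 0ℓ} ℓ → Decidable P → Dec (∃[ W ] (length W ≡ ℓ × P W))
any-list? zero P? = Dec.map′ (λ p → [] , refl , p) (λ { ([] , _ , p) → p }) (P? [])
any-list? (suc ℓ) P? =
  Dec.map′ (λ { (a , W , len , p) → a ∷ W , cong suc len , p })
           (λ { ([] , () , _) ; (a ∷ W , len , p) → a , W , ℕ.suc-injective len , p })
           (any? λ a → any-list? ℓ (P? ∘ (a ∷_)))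

lookup-injective : ∀ {A : Set} {W : List A} → AllPairs _≢_ W → Injective _≡_ _≡_ (lookup W)
lookup-injective (_ ∷ _) {Fin.zero} {Fin.zero} _ = refl
lookup-injective (fresh ∷ _) {Fin.zero} {Fin.suc j} eq = contradiction eq (All.lookup fresh (∈-lookup j))
lookup-injective (fresh ∷ _) {Fin.suc i} {Fin.zero} eq = contradiction (sym eq) (All.lookup fresh (∈-lookup i))
lookup-injective (_ ∷ distinct) {Fin.suc i} {Fin.suc j} eq = cong Fin.suc (lookup-injective distinct eq)

Walk : ∀ {n} → (Fin n → Fin n → Bool) → Pred (Fin n) 0ℓ → Fin n → Fin n → Set
Walk E Q = Star (λ a b → Q a × Arc E a b)

module BFS {n : ℕ} (E : Fin n → Fin n → Bool) (s : Fin n)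
           {Open : Pred (Fin n) 0ℓ} (open? : Decidable Open) where

  private variable
    a u v : Fin n
    d e : ℕ

  Discovers : Subset n → Fin n → Fin n → Set
  Discovers p v u = u ∈ₛ p × Open u × Arc E u v

  discovers? : ∀ p v → Decidable (Discovers p v)
  discovers? p v u = (u ∈ₛ? p) ×-dec (open? u ×-dec (E u v ≟ᵇ true))

  layer : ℕ → Subset n
  layer zero = ⁅ s ⁆
  layer (suc d) = layer d ∪ fromDec (λ v → any? (discovers? (layer d) v))

  layer-step⁺ : ∀ d → Discovers (layer d) v u → v ∈ₛ layer (suc d)
  layer-step⁺ d disc = x∈p∪q⁺ (inj₂ (∈-fromDec⁺ (λ v → any? (discovers? (layer d) v)) (_ , disc)))

  layer-step⁻ : ∀ d → v ∈ₛ layer (suc d) → v ∈ₛ layer d ⊎ ∃ (Discovers (layer d) v)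
  layer-step⁻ d v∈ =
    Sum.map₂ (∈-fromDec⁻ (λ v → any? (discovers? (layer d) v))) (x∈p∪q⁻ (layer d) _ v∈)

  layer-mono : d ≤ e → layer d ⊆ layer e
  layer-mono = go ∘ ℕ.≤⇒≤′
    where
      go : d ≤′ e → layer d ⊆ layer e
      go (≤′-reflexive refl) = id
      go (≤′-step d≤e) = p⊆p∪q _ ∘ go d≤e

  root∈layer : ∀ d → s ∈ₛ layer d
  root∈layer d = layer-mono (z≤n {d}) (x∈⁅x⁆ s)

  Reached : Pred (Fin n) 0ℓ
  Reached v = ∃[ d ] (v ∈ₛ layer d)

  Parent : Fin n → Fin n → Set
  Parent a v = ∃[ d ] (v ∉ₛ layer d × choice (any? (discovers? (layer d) v)) ≡ just a)

  parent-discovers : ((d , _) : Parent a v) → Discovers (layer d) v a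
  parent-discovers (d , _ , chosen) = choice-sound (any? _) chosen

  parent-exists : ∀ d → v ∉ₛ layer d → v ∈ₛ layer (suc d) → ∃[ a ] (Parent a v × a ∈ₛ layer d)
  parent-exists d v∉ v∈ with layer-step⁻ d v∈
  ... | inj₁ v∈d = contradiction v∈d v∉
  ... | inj₂ disc with choice-complete (any? (discovers? (layer d) _)) disc
  ...   | a , chosen = a , (d , v∉ , chosen) , proj₁ (choice-sound (any? _) chosen)

  -- The round in which v is discovered is determined, hence so is its parent.
  parent-unique : Parent a v → Parent u v → u ≡ a
  parent-unique par@(d , v∉ , chosen) par'@(d' , v∉' , chosen') with ℕ.<-cmp d d'
  ... | tri< d<d' _ _ = contradiction (layer-mono d<d' (layer-step⁺ d (parent-discovers par))) v∉'
  ... | tri> _ _ d'<d = contradiction (layer-mono d'<d (layer-step⁺ d' (parent-discovers par'))) v∉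
  ... | tri≈ _ refl _ = just-injective (trans (sym chosen') chosen)

  first-round : ∀ d → v ∈ₛ layer d → v ≢ s → ∃[ e ] (v ∉ₛ layer e × v ∈ₛ layer (suc e))
  first-round zero v∈ v≢s = contradiction (x∈⁅y⁆⇒x≡y s v∈) v≢s
  first-round {v} (suc d) v∈ v≢s with v ∈ₛ? layer d
  ... | yes v∈d = first-round d v∈d v≢s
  ... | no v∉d = d , v∉d , v∈

  parent-path : ∀ d → v ∈ₛ layer d → Star Parent s v
  parent-path zero v∈ with x∈⁅y⁆⇒x≡y s v∈
  ... | refl = ε
  parent-path {v} (suc d) v∈ with v ∈ₛ? layer d
  ... | yes v∈d = parent-path d v∈d
  ... | no v∉d with parent-exists d v∉d v∈
  ...   | _ , par , a∈ = parent-path d a∈ ◅◅ (par ◅ ε)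

  tree : OutTree E s
  tree = record
    { V        = Reached
    ; A        = Parent
    ; A⊆Arc    = λ par → proj₂ (proj₂ (parent-discovers par))
    ; A-ends   = ends
    ; root∈    = 0 , x∈⁅x⁆ s
    ; root-in0 = λ { _ (d , s∉ , _) → s∉ (root∈layer d) }
    ; in1      = unique-parent
    ; reach    = λ { v (d , v∈) → parent-path d v∈ }
    }
    where
      ends : Parent a v → Reached a × Reached v
      ends par@(d , _) = (d , proj₁ (parent-discovers par)) , (suc d , layer-step⁺ d (parent-discovers par))

      unique-parent : ∀ v → Reached v → v ≢ s → ∃[ a ] (Parent a v × (∀ a' → Parent a' v → a' ≡ a))
      unique-parent v (d , v∈) v≢s with first-round d v∈ v≢s
      ... | e , v∉ , v∈' with parent-exists e v∉ v∈'
      ...   | a , par , _ = a , par , λ _ par' → parent-unique par par'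

  -- Closed vertices are never expanded, so they are leaves.
  closed-leaf : ¬ Open v → Reached v → OutTree.Leaf tree v
  closed-leaf closed reached = reached , λ _ par → closed (proj₁ (proj₂ (parent-discovers par)))

  walk-reached : ∀ d → Walk E Open a v → a ∈ₛ layer d → Reached v
  walk-reached d ε a∈ = d , a∈
  walk-reached d ((open-a , arc) ◅ walk) a∈ = walk-reached (suc d) walk (layer-step⁺ d (a∈ , open-a , arc))

  -- Saturation: once a round discovers nothing new, no later round does, and
  -- since layers only grow, this happens within n rounds.
  Stable : ℕ → Set
  Stable d = layer (suc d) ⊆ layer d

  stable-forever : ∀ d → Stable d → ∀ j → layer (j + d) ⊆ layer d
  stable-forever d st zero = id
  stable-forever d st (suc j) v∈ with layer-step⁻ (j + d) v∈
  ... | inj₁ v∈' = stable-forever d st j v∈'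
  ... | inj₂ (_ , u∈ , open-u , arc) = st (layer-step⁺ d (stable-forever d st j u∈ , open-u , arc))

  stable-or-grows : ∀ d → Stable d ⊎ layer d ⊂ layer (suc d)
  stable-or-grows d with layer d ⊂? layer (suc d)
  ... | yes grows = inj₂ grows
  ... | no ¬grows = inj₁ λ {v} v∈ →
          decidable-stable (v ∈ₛ? layer d) (λ v∉ → ¬grows (p⊆p∪q _ , v , v∈ , v∉))

  growth : ∀ d → (∃[ e ] (e ≤ d × Stable e)) ⊎ suc d ≤ ∣ layer d ∣
  growth zero = inj₂ (ℕ.≤-reflexive (sym (∣⁅x⁆∣≡1 s)))
  growth (suc d) with growth d
  ... | inj₁ (e , e≤d , st) = inj₁ (e , ℕ.m≤n⇒m≤1+n e≤d , st)
  ... | inj₂ large with stable-or-grows d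
  ...   | inj₁ st = inj₁ (d , ℕ.n≤1+n d , st)
  ...   | inj₂ grows = inj₂ (ℕ.≤-trans (s≤s large) (p⊂q⇒∣p∣<∣q∣ grows))

  stabilises : ∃[ e ] (e ≤ n × Stable e)
  stabilises with growth n
  ... | inj₁ st = st
  ... | inj₂ large = contradiction (ℕ.≤-trans large (∣p∣≤n (layer n))) ℕ.1+n≰n

  saturated : Reached v → v ∈ₛ layer n
  saturated {v} (d , v∈) with stabilises
  ... | e , e≤n , st with ℕ.≤-total d e
  ...   | inj₁ d≤e = layer-mono e≤n (layer-mono d≤e v∈)
  ...   | inj₂ e≤d = layer-mono e≤n
          (stable-forever e st (d ∸ e) (subst (λ t → v ∈ₛ layer t) (sym (ℕ.m∸n+n≡m e≤d)) v∈))

module CutDecomposition {n : ℕ} (E : Fin n → Fin n → Bool) where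
  open import Data.List.Membership.DecPropositional (_≟_ {n}) using (_∈?_)

  private variable
    U : Pred (Fin n) 0ℓ
    Q : Pred (Fin n) 0ℓ
    a c r t w x y z : Fin n
    vs : List (Fin n)
    W W' : List (Fin n)
    k ℓ : ℕ

  path-end∈ : DPath E U a c vs → c ∈ vs
  path-end∈ (single _) = here refl
  path-end∈ (cons _ _ p _) = there (path-end∈ p)

  path-inside : DPath E U a c vs → z ∈ vs → U z
  path-inside (single Ua) (here refl) = Ua
  path-inside (cons Ua _ _ _) (here refl) = Ua
  path-inside (cons _ _ p _) (there z∈) = path-inside p z∈

  path-walk : DPath E U a c vs → (∀ {z} → z ∈ vs → z ≢ c → Q z) → Walk E Q a c
  path-walk (single _) _ = ε
  path-walk (cons _ arc p a∉) q =
    (q (here refl) (λ { refl → a∉ (path-end∈ p) }) , arc) ◅ path-walk p (q ∘ there)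

  -- The initial segment of a path up to one of its vertices z; since paths do
  -- not repeat vertices, it contains the end c only if z = c.
  path-prefix : DPath E U a c vs → z ∈ vs →
    ∃[ pr ] (DPath E U a z pr × (∀ {t} → t ∈ pr → t ∈ vs) × (c ∈ pr → z ≡ c))
  path-prefix (single Ua) (here refl) = _ , single Ua , id , λ _ → refl
  path-prefix (cons Ua _ _ _) (here refl) =
    _ , single Ua , (λ { (here refl) → here refl }) , (λ { (here c≡a) → sym c≡a })
  path-prefix (cons Ua arc p a∉) (there z∈) with path-prefix p z∈
  ... | pr , q , pr⊆ , ends-at-z =
    _ , cons Ua arc q (a∉ ∘ pr⊆) ,
    (λ { (here refl) → here refl ; (there t∈) → there (pr⊆ t∈) }) ,
    (λ { (here refl) → contradiction (path-end∈ p) a∉ ; (there c∈) → ends-at-z c∈ })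

  lastIn∈ : ∀ {B : Pred (Fin n) 0ℓ} → LastIn E B vs x → x ∈ vs
  lastIn∈ (_ , pre , _ , refl , _) = ∈-++⁺ʳ pre (here refl)

  X-behind-x : DPath E U r c vs → z ∈ vs → Xset E U r x z → x ∈ vs
  X-behind-x p z∈ (_ , _ , last) with path-prefix p z∈
  ... | pr , q , pr⊆ , _ = pr⊆ (lastIn∈ (last pr q))

  X-off-path-to-x : DPath E U r x vs → z ∈ vs → ¬ Xset E U r x z
  X-off-path-to-x p z∈ (_ , z∉B , last) with path-prefix p z∈
  ... | pr , q , _ , ends-at-z with last pr q
  ... | x∈B , lastIn =
    z∉B (subst (Diblock E _ _) (sym (ends-at-z (lastIn∈ (x∈B , lastIn)))) x∈B)

  arc-path : U r → U w → Arc E r w → w ≢ r → DPath E U r w (r ∷ w ∷ [])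
  arc-path Ur Uw arc w≢r = cons Ur arc (single Uw) λ { (here r≡w) → w≢r (sym r≡w) }

  diblock-path : U r → Diblock E U r w → w ≢ r → ∃ (DPath E U r w)
  diblock-path _ (_ , inj₁ w≡r) w≢r = contradiction w≡r w≢r
  diblock-path Ur (Uw , inj₂ (inj₁ arc)) w≢r = _ , arc-path Ur Uw arc w≢r
  diblock-path _ (_ , inj₂ (inj₂ (ps , _ , p , _))) _ = ps , p

  diblock-path-avoiding : U r → Diblock E U r w → w ≢ r → t ≢ r → t ≢ w →
    ∃[ vs ] (DPath E U r w vs × t ∉ vs)
  diblock-path-avoiding _ (_ , inj₁ w≡r) w≢r _ _ = contradiction w≡r w≢r
  diblock-path-avoiding Ur (Uw , inj₂ (inj₁ arc)) w≢r t≢r t≢w =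
    _ , arc-path Ur Uw arc w≢r , λ { (here t≡r) → t≢r t≡r ; (there (here t≡w)) → t≢w t≡w }
  diblock-path-avoiding {t = t} _ (_ , inj₂ (inj₂ (ps , qs , p , q , disjoint))) _ t≢r t≢w
    with t ∈? ps | t ∈? qs
  ... | no t∉ps | _ = ps , p , t∉ps
  ... | yes _ | no t∉qs = qs , q , t∉qs
  ... | yes t∈ps | yes t∈qs = contradiction₂ (disjoint t t∈ps t∈qs) t≢r t≢w

  -- A non-degenerate diblock B_r with a bottleneck x is not {r, x}, so
  -- (classically) it has a third vertex.
  third-vertex : U r → Bottleneck E U r x → ¬ Degenerate E U r →
    ¬ ¬ (∃[ w ] (Diblock E U r w × w ≢ r × w ≢ x))
  third-vertex {r = r} {x = x} Ur bot@(x∈B , x≢r , _) nondegenerate no-third =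
    nondegenerate ((x , bot) , r , x , (x≢r ∘ sym) , (Ur , inj₁ refl) , x∈B , only-r-x)
    where
      only-r-x : ∀ w → Diblock E _ r w → w ≡ r ⊎ w ≡ x
      only-r-x w w∈B with w ≟ r | w ≟ x
      ... | yes w≡r | _ = inj₁ w≡r
      ... | no _ | yes w≡x = inj₂ w≡x
      ... | no w≢r | no w≢x = contradiction (w , w∈B , w≢r , w≢x) no-third

  Avoiding : Pred (Fin n) 0ℓ → List (Fin n) → Pred (Fin n) 0ℓ
  Avoiding U W z = U z × z ∉ W

  -- ℓ distinct vertices of H[U], each reached from r by a walk in H[U] whose
  -- earlier vertices avoid all of them; a search that never expands them
  -- makes each of them a leaf.
  record LeafCandidates (U : Pred (Fin n) 0ℓ) (r : Fin n) (ℓ : ℕ) : Set where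
    constructor candidates
    field
      members  : List (Fin n)
      size     : length members ≡ ℓ
      distinct : AllPairs _≢_ members
      inside   : All U members
      reached  : All (Walk E (Avoiding U members) r) members

  module AtBottleneck (Ur : U r) (bot : Bottleneck E U r x) where
    x∈B : Diblock E U r x
    x∈B = proj₁ bot

    x≢r : x ≢ r
    x≢r = proj₁ (proj₂ bot)

    U' : Pred (Fin n) 0ℓ
    U' = SubSet E U r x

    U'⊆U : U' z → U z
    U'⊆U (inj₁ (Uz , _)) = Uz
    U'⊆U (inj₂ refl) = proj₁ x∈B

    diblock∉U' : Diblock E U r z → z ≢ x → ¬ U' z
    diblock∉U' z∈B _ (inj₁ (_ , z∉B , _)) = z∉B z∈B
    diblock∉U' _ z≢x (inj₂ z≡x) = z≢x z≡x

    U'-on-path-to-x : DPath E U r x vs → z ∈ vs → U' z → z ≡ x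
    U'-on-path-to-x p z∈ (inj₁ Xz) = contradiction Xz (X-off-path-to-x p z∈)
    U'-on-path-to-x _ _ (inj₂ z≡x) = z≡x

    U'-off-path-avoiding-x : DPath E U r c vs → x ∉ vs → z ∈ vs → ¬ U' z
    U'-off-path-avoiding-x p x∉ z∈ (inj₁ Xz) = x∉ (X-behind-x p z∈ Xz)
    U'-off-path-avoiding-x _ x∉ z∈ (inj₂ refl) = x∉ z∈

    prepend : DPath E U r x vs → (∀ {z} → z ∈ vs → z ≢ x → z ∉ W') →
      (∀ {z} → U' z → z ∉ W → z ∉ W') →
      Walk E (Avoiding U' W) x w → Walk E (Avoiding U W') r w
    prepend p off-path off-U' walk =
      path-walk p (λ z∈ z≢x → path-inside p z∈ , off-path z∈ z≢x) ◅◅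
      Star.map (λ { ((U'z , z∉W) , arc) → (U'⊆U U'z , off-U' U'z z∉W) , arc }) walk

    -- A degenerate diblock passes the candidates of the subproblem up unchanged.
    through : LeafCandidates U' x ℓ → LeafCandidates U r ℓ
    through (candidates W size distinct inside reached) with diblock-path Ur x∈B x≢r
    ... | _ , p = candidates W size distinct (All.map U'⊆U inside)
                    (All.map (prepend p off-path (λ _ z∉W → z∉W)) reached)
      where
        off-path : z ∈ _ → z ≢ x → z ∉ W
        off-path z∈ z≢x z∈W = z≢x (U'-on-path-to-x p z∈ (All.lookup inside z∈W))

    -- A non-degenerate diblock adds its third vertex w to the candidates:
    -- x is reached avoiding w, and w is reached avoiding x and thus all of U'.
    add : ∃[ w ] (Diblock E U r w × w ≢ r × w ≢ x) → LeafCandidates U' x ℓ → LeafCandidates U r (suc ℓ)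
    add (w , w∈B , w≢r , w≢x) (candidates W size distinct inside reached)
      with diblock-path-avoiding Ur x∈B x≢r w≢r w≢x | diblock-path-avoiding Ur w∈B w≢r x≢r (w≢x ∘ sym)
    ... | _ , p , w∉p | _ , q , x∉q =
      candidates (w ∷ W) (cong suc size) (All.tabulate w-fresh ∷ distinct)
        (proj₁ w∈B ∷ All.map U'⊆U inside) (walk-to-w ∷ All.map (prepend p off-path off-U') reached)
      where
        w-fresh : z ∈ W → w ≢ z
        w-fresh z∈W refl = diblock∉U' w∈B w≢x (All.lookup inside z∈W)

        off-path : z ∈ _ → z ≢ x → z ∉ w ∷ W
        off-path z∈ _ (here refl) = w∉p z∈
        off-path z∈ z≢x (there z∈W) = z≢x (U'-on-path-to-x p z∈ (All.lookup inside z∈W))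

        off-U' : U' z → z ∉ W → z ∉ w ∷ W
        off-U' U'z _ (here refl) = diblock∉U' w∈B w≢x U'z
        off-U' _ z∉W (there z∈W) = z∉W z∈W

        walk-to-w : Walk E (Avoiding U (w ∷ W)) _ w
        walk-to-w = path-walk q λ z∈ z≢w → path-inside q z∈ , λ
          { (here refl) → z≢w refl
          ; (there z∈W) → U'-off-path-avoiding-x q x∉q z∈ (All.lookup inside z∈W) }

  open RawMonad (¬¬-Monad {0ℓ}) using (_>>=_; pure)

  candidates-along : TreePath E U r y k → U r → ∀ ℓ → ℓ ≤ k → ¬ ¬ LeafCandidates U r ℓ
  candidates-along _ _ zero _ = pure (candidates [] refl [] [] [])
  candidates-along {r = r} (stop-nd _) Ur (suc zero) _ =
    pure (candidates (r ∷ []) refl ([] ∷ []) (Ur ∷ []) (ε ∷ []))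
  candidates-along (stop-nd _) _ (suc (suc _)) (s≤s ())
  candidates-along (stop-d _) _ (suc _) ()
  candidates-along (step-d _ bot path) Ur ℓ ℓ≤k =
    ¬¬-map (AtBottleneck.through Ur bot) (candidates-along path (inj₂ refl) ℓ ℓ≤k)
  candidates-along (step-nd nondegenerate bot path) Ur (suc ℓ) (s≤s ℓ≤k) = do
    third ← third-vertex Ur bot nondegenerate
    cands ← candidates-along path (inj₂ refl) ℓ ℓ≤k
    pure (AtBottleneck.add Ur bot third cands)

module Leaves {n : ℕ} (E : Fin n → Fin n → Bool) (s : Fin n) where
  open import Data.List.Membership.DecPropositional (_≟_ {n}) using (_∈?_)
  open CutDecomposition E using (LeafCandidates; candidates)

  module Blocked (W : List (Fin n)) = BFS E s (λ z → ¬? (z ∈? W))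

  Good : List (Fin n) → Set
  Good W = AllPairs _≢_ W × All (_∈ₛ Blocked.layer W n) W

  good? : Decidable Good
  good? W = AllPairs.allPairs? (λ a b → ¬? (a ≟ b)) W ×-dec All.all? (λ w → w ∈ₛ? Blocked.layer W n) W

  candidates-good : ∀ {ℓ} → LeafCandidates (All-V E) s ℓ → ∃[ W ] (length W ≡ ℓ × Good W)
  candidates-good (candidates W size distinct _ reached) =
    W , size , distinct , All.map found reached
    where
      found : ∀ {w} → Walk E (CutDecomposition.Avoiding E (All-V E) W) s w → w ∈ₛ Blocked.layer W n
      found walk = Blocked.saturated W
        (Blocked.walk-reached W 0 (Star.map (λ { ((_ , z∉W) , arc) → z∉W , arc }) walk) (x∈⁅x⁆ s))

  good-tree : ∀ {W} → Good W → ∃[ T ] AtLeastLeaves E {s} T (length W)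
  good-tree {W} (distinct , found) =
    Blocked.tree W , lookup W , lookup-injective distinct , λ i →
      Blocked.closed-leaf W (λ w∉W → w∉W (∈-lookup i)) (n , All.lookup found (∈-lookup i))

lemma11 : ∀ {n : ℕ} (E : Fin n → Fin n → Bool) (s : Fin n) →
    2 ≤ n →
    (∀ v → Reachable E (All-V E) s v) →
    ∀ (y : Fin n) (ℓ k : ℕ) →
    TreePath E (All-V E) s y k → ℓ ≤ k →
    ∃[ T ] AtLeastLeaves E {s} T ℓ
lemma11 E s _ _ _ ℓ _ path ℓ≤k =
  tree-of (decidable-stable (any-list? ℓ good?) (¬¬-map candidates-good (candidates-along path tt ℓ ℓ≤k)))
  where
    open Leaves E s
    open CutDecomposition E using (candidates-along)

    tree-of : ∃[ W ] (length W ≡ ℓ × Good W) → ∃[ T ] AtLeastLeaves E {s} T ℓ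
    tree-of (_ , refl , good) = good-tree good
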